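{- Let $A$ be an $n\times n$ matrix with entries in $\{0,1\}$, whose off-diagonal entries are fixed and whose diagonal entries $a_{11},\ldots,a_{nn}\in\{0,1\}$ are chosen uniformly and independently at random. Then the expected number of vectors $\mathbf x\in\{0,1\}^n$ satisfying $\mathbf x\circ A\mathbf x=\mathbf x$ over $\mathrm{GF}(2)$ is $1.5^n$.
   Context: $\circ$ denotes the coordinate-wise (Hadamard) product of vectors; so the equation says that for every $i$, $x_i\sum_{j=1}^n a_{ij}x_j = x_i$ over $\mathrm{GF}(2)$. -}

module Defs where

open import Data.Nat using (ℕ; zero; suc)
open import Data.Bool using (Bool; true; false; _xor_; _∧_; if_then_else_)
open import Data.Bool.Properties using () renaming (_≟_ to _≟ᵇ_)
open import Data.Fin using (Fin; zero; suc; _≟_)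
open import Data.Fin.Properties using (all?)
open import Data.List using (List; []; _∷_; [_]; concatMap; map; foldr; tabulate; filter; length)
open import Data.Nat.ListAction using (sum)
open import Relation.Nullary using (does)
open import Relation.Binary.PropositionalEquality using (_≡_)

-- Vectors over GF(2) = Bool (xor is addition, ∧ is multiplication)
BVec : ℕ → Set
BVec n = Fin n → Bool

BMat : ℕ → Set
BMat n = Fin n → Fin n → Bool

allVecs : (n : ℕ) → List (BVec n)
allVecs zero = [ (λ ()) ]
allVecs (suc n) = concatMap (λ v → (λ { zero → false ; (suc i) → v i })
                                 ∷ (λ { zero → true ; (suc i) → v i }) ∷ []) (allVecs n)

⊕ : {n : ℕ} → (Fin n → Bool) → Bool
⊕ {n} f = foldr _xor_ false (tabulate f)

mulVec : {n : ℕ} → BMat n → BVec n → BVec n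
mulVec A x i = ⊕ (λ j → A i j ∧ x j)

IsSol : {n : ℕ} → BMat n → BVec n → Set
IsSol A x = ∀ i → (x i ∧ mulVec A x i) ≡ x i

isSol? : {n : ℕ} → (A : BMat n) → (x : BVec n) → Relation.Nullary.Dec (IsSol A x)
isSol? A x = all? (λ i → (x i ∧ mulVec A x i) ≟ᵇ x i)

numSol : {n : ℕ} → BMat n → ℕ
numSol {n} A = length (filter (isSol? A) (allVecs n))

-- matrix with off-diagonal entries from B (its diagonal is ignored) and diagonal d
withDiag : {n : ℕ} → BMat n → BVec n → BMat n
withDiag B d i j = if does (i ≟ j) then d i else B i j

-- sum over all 2^n diagonals of the number of solutions (= 2^n · expectation)
totalSol : {n : ℕ} → BMat n → ℕ
totalSol {n} B = sum (map (λ d → numSol (withDiag B d)) (allVecs n))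

-- Exchanging the two sums, the total counts pairs (d, x) with x a solution for the
-- diagonal d.  For fixed x, the i-th equation x_i (A x)_i = x_i involves d only through
-- d_i: it holds for both values of d_i when x_i = 0, and for exactly one when x_i = 1,
-- since then d_i enters (A x)_i as a summand.  So x is a solution for 2^(#zeros of x)
-- diagonals, and summing over x gives (2 + 1)^n.
module Submission where

open import Defs
open import Algebra.Properties.CommutativeSemigroup using (interchange)
open import Data.Bool using (Bool; true; false; not; _∧_; _xor_; if_then_else_)
open import Data.Bool.Properties using (not-distribˡ-xor; not-distribʳ-xor) renaming (_≟_ to _≟ᵇ_)
open import Data.Fin using (Fin; zero; suc; _≟_)
open import Data.Fin.Properties using (all?; ∀-cons-⇔; suc-injective)
open import Data.List using (List; []; _∷_; concatMap; map; _++_; foldr; filter; length)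
open import Data.List.Properties using (map-cong; map-++; tabulate-cong)
open import Data.Nat using (ℕ; zero; suc; _+_; _*_; _^_)
open import Data.Nat.ListAction using (sum)
open import Data.Nat.ListAction.Properties using (sum-++)
open import Data.Nat.Properties using (*-1-monoid; +-commutativeSemigroup; *-zeroʳ; *-distribˡ-+; *-distribʳ-+; +-identityʳ)
open import Algebra.Properties.Monoid.Sum *-1-monoid using (sum-cong-≗) renaming (sum to ∏)
open import Level using (Level)
open import Function using (_∘_; flip)
open import Relation.Nullary using (Dec; does; _×-dec_)
open import Relation.Nullary.Decidable using (does-⇔; dec-true; dec-false)
open import Relation.Unary using (Pred; Decidable)
open import Relation.Binary.PropositionalEquality using (_≡_; _≢_; _≗_; refl; sym; cong; cong₂; module ≡-Reasoning)
open ≡-Reasoning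

private
  variable
    a b : Level
    X Y : Set a

sum-map-+ : (f g : X → ℕ) (xs : List X) →
            sum (map (λ x → f x + g x) xs) ≡ sum (map f xs) + sum (map g xs)
sum-map-+ f g []       = refl
sum-map-+ f g (x ∷ xs) = begin
  f x + g x + sum (map (λ x → f x + g x) xs)       ≡⟨ cong (f x + g x +_) (sum-map-+ f g xs) ⟩
  f x + g x + (sum (map f xs) + sum (map g xs))     ≡⟨ interchange +-commutativeSemigroup (f x) (g x) _ _ ⟩
  f x + sum (map f xs) + (g x + sum (map g xs))     ∎

sum-map-*ˡ : (c : ℕ) (f : X → ℕ) (xs : List X) → sum (map (λ x → c * f x) xs) ≡ c * sum (map f xs)
sum-map-*ˡ c f []       = sym (*-zeroʳ c)
sum-map-*ˡ c f (x ∷ xs) = begin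
  c * f x + sum (map (λ x → c * f x) xs)  ≡⟨ cong (c * f x +_) (sum-map-*ˡ c f xs) ⟩
  c * f x + c * sum (map f xs)            ≡⟨ *-distribˡ-+ c (f x) _ ⟨
  c * (f x + sum (map f xs))              ∎

sum-map-concatMap : (f : Y → ℕ) (g : X → List Y) (xs : List X) →
                    sum (map f (concatMap g xs)) ≡ sum (map (λ x → sum (map f (g x))) xs)
sum-map-concatMap f g []       = refl
sum-map-concatMap f g (x ∷ xs) = begin
  sum (map f (g x ++ concatMap g xs))                         ≡⟨ cong sum (map-++ f (g x) _) ⟩
  sum (map f (g x) ++ map f (concatMap g xs))                 ≡⟨ sum-++ (map f (g x)) _ ⟩
  sum (map f (g x)) + sum (map f (concatMap g xs))            ≡⟨ cong (sum (map f (g x)) +_) (sum-map-concatMap f g xs) ⟩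
  sum (map f (g x)) + sum (map (λ x → sum (map f (g x))) xs) ∎

sum-map-swap : (f : X → Y → ℕ) (xs : List X) (ys : List Y) →
               sum (map (λ x → sum (map (f x) ys)) xs) ≡ sum (map (λ y → sum (map (flip f y) xs)) ys)
sum-map-swap f []       []       = refl
sum-map-swap f []       (_ ∷ ys) = sum-map-swap f [] ys
sum-map-swap f (x ∷ xs) ys       = begin
  sum (map (f x) ys) + sum (map (λ x → sum (map (f x) ys)) xs)        ≡⟨ cong (sum (map (f x) ys) +_) (sum-map-swap f xs ys) ⟩
  sum (map (f x) ys) + sum (map (λ y → sum (map (flip f y) xs)) ys)   ≡⟨ sum-map-+ (f x) (λ y → sum (map (flip f y) xs)) ys ⟨
  sum (map (λ y → f x y + sum (map (flip f y) xs)) ys)                ∎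

𝟙 : Bool → ℕ
𝟙 b = if b then 1 else 0

𝟙-∧ : ∀ x y → 𝟙 (x ∧ y) ≡ 𝟙 x * 𝟙 y
𝟙-∧ true  y = sym (+-identityʳ (𝟙 y))
𝟙-∧ false y = refl

length-filter≡sum-𝟙 : {P : Pred X b} (P? : Decidable P) (xs : List X) →
                      length (filter P? xs) ≡ sum (map (𝟙 ∘ does ∘ P?) xs)
length-filter≡sum-𝟙 P? []       = refl
length-filter≡sum-𝟙 P? (x ∷ xs) with does (P? x)
... | true  = cong suc (length-filter≡sum-𝟙 P? xs)
... | false = length-filter≡sum-𝟙 P? xs

∏-const : ∀ n (m : ℕ) → ∏ {n} (λ _ → m) ≡ m ^ n
∏-const zero    m = refl
∏-const (suc n) m = cong (m *_) (∏-const n m)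

𝟙-all? : ∀ {n} {P : Pred (Fin n) b} (P? : Decidable P) → 𝟙 (does (all? P?)) ≡ ∏ (𝟙 ∘ does ∘ P?)
𝟙-all? {n = zero}  P? = refl
𝟙-all? {n = suc n} P? = begin
  𝟙 (does (all? P?))                                  ≡⟨ cong 𝟙 (does-⇔ ∀-cons-⇔ (P? zero ×-dec all? (P? ∘ suc)) (all? P?)) ⟨
  𝟙 (does (P? zero) ∧ does (all? (P? ∘ suc)))         ≡⟨ 𝟙-∧ (does (P? zero)) _ ⟩
  𝟙 (does (P? zero)) * 𝟙 (does (all? (P? ∘ suc)))     ≡⟨ cong (𝟙 (does (P? zero)) *_) (𝟙-all? (P? ∘ suc)) ⟩
  𝟙 (does (P? zero)) * ∏ (𝟙 ∘ does ∘ P? ∘ suc)        ∎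

∑ᵥ : ∀ {n} → (BVec n → ℕ) → ℕ
∑ᵥ {n} f = sum (map f (allVecs n))

∑ᵥ-∏ : ∀ n (r : Fin n → Bool → ℕ) → ∑ᵥ (λ d → ∏ (λ i → r i (d i))) ≡ ∏ (λ i → r i false + r i true)
∑ᵥ-∏ zero    r = refl
∑ᵥ-∏ (suc n) r = begin
  ∑ᵥ (λ d → ∏ (λ i → r i (d i)))                   ≡⟨ sum-map-concatMap _ _ (allVecs n) ⟩
  ∑ᵥ (λ v → r₀ false * R v + (r₀ true * R v + 0))  ≡⟨ cong sum (map-cong factor (allVecs n)) ⟩
  ∑ᵥ (λ v → (r₀ false + r₀ true) * R v)            ≡⟨ sum-map-*ˡ (r₀ false + r₀ true) R (allVecs n) ⟩
  (r₀ false + r₀ true) * ∑ᵥ R                      ≡⟨ cong ((r₀ false + r₀ true) *_) (∑ᵥ-∏ n (r ∘ suc)) ⟩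
  ∏ (λ i → r i false + r i true)                   ∎
  where
  r₀ : Bool → ℕ
  r₀ = r zero
  R : BVec n → ℕ
  R v = ∏ (λ i → r (suc i) (v i))
  factor : ∀ v → r₀ false * R v + (r₀ true * R v + 0) ≡ (r₀ false + r₀ true) * R v
  factor v = begin
    r₀ false * R v + (r₀ true * R v + 0)  ≡⟨ cong (r₀ false * R v +_) (+-identityʳ _) ⟩
    r₀ false * R v + r₀ true * R v        ≡⟨ *-distribʳ-+ (R v) (r₀ false) _ ⟨
    (r₀ false + r₀ true) * R v            ∎

⊕-cong : ∀ {n} {f g : BVec n} → f ≗ g → ⊕ f ≡ ⊕ g
⊕-cong = cong (foldr _xor_ false) ∘ tabulate-cong

⊕-flip : ∀ {n} (i : Fin n) {f g : BVec n} → (∀ j → i ≢ j → f j ≡ g j) → f i ≡ not (g i) → ⊕ f ≡ not (⊕ g)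
⊕-flip zero {f} {g} agree flipped = begin
  f zero xor ⊕ (f ∘ suc)          ≡⟨ cong₂ _xor_ flipped (⊕-cong (λ j → agree (suc j) λ ())) ⟩
  not (g zero) xor ⊕ (g ∘ suc)    ≡⟨ not-distribˡ-xor (g zero) _ ⟨
  not (⊕ g)                       ∎
⊕-flip (suc i) {f} {g} agree flipped = begin
  f zero xor ⊕ (f ∘ suc)          ≡⟨ cong₂ _xor_ (agree zero λ ()) (⊕-flip i (λ j i≢j → agree (suc j) (i≢j ∘ suc-injective)) flipped) ⟩
  g zero xor not (⊕ (g ∘ suc))    ≡⟨ not-distribʳ-xor (g zero) _ ⟨
  not (⊕ g)                       ∎

-- (A x)ᵢ for the matrix A with off-diagonal part B and aᵢᵢ = b; for A = withDiag B d
-- this is definitionally mulVec A x i with b = d i.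
rowDot : ∀ {n} → BMat n → BVec n → Fin n → Bool → Bool
rowDot B x i b = ⊕ (λ j → (if does (i ≟ j) then b else B i j) ∧ x j)

rowDot-flip : ∀ {n} (B : BMat n) (x : BVec n) (i : Fin n) → x i ≡ true →
              rowDot B x i true ≡ not (rowDot B x i false)
rowDot-flip B x i xᵢ = ⊕-flip i offDiagonal diagonal
  where
  offDiagonal : ∀ j → i ≢ j → (if does (i ≟ j) then true else B i j) ∧ x j
                            ≡ (if does (i ≟ j) then false else B i j) ∧ x j
  offDiagonal j i≢j rewrite dec-false (i ≟ j) i≢j = refl
  diagonal : (if does (i ≟ i) then true else B i i) ∧ x i ≡ not ((if does (i ≟ i) then false else B i i) ∧ x i)
  diagonal rewrite dec-true (i ≟ i) refl = xᵢ

holdsAt? : ∀ {n} (B : BMat n) (x : BVec n) (i : Fin n) (b : Bool) → Dec ((x i ∧ rowDot B x i b) ≡ x i)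
holdsAt? B x i b = (x i ∧ rowDot B x i b) ≟ᵇ x i

diagChoices : Bool → ℕ
diagChoices false = 2
diagChoices true  = 1

holdsAt-count : ∀ {n} (B : BMat n) (x : BVec n) (i : Fin n) →
                𝟙 (does (holdsAt? B x i false)) + 𝟙 (does (holdsAt? B x i true)) ≡ diagChoices (x i)
holdsAt-count B x i with x i in xᵢ
... | false = refl
... | true  = exactlyOne (rowDot-flip B x i xᵢ)
  where
  exactlyOne : ∀ {y z} → z ≡ not y → 𝟙 (does (y ≟ᵇ true)) + 𝟙 (does (z ≟ᵇ true)) ≡ 1
  exactlyOne {true}  refl = refl
  exactlyOne {false} refl = refl

diagonalsSolving : ∀ {n} (B : BMat n) (x : BVec n) →
                   ∑ᵥ (λ d → 𝟙 (does (isSol? (withDiag B d) x))) ≡ ∏ (diagChoices ∘ x)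
diagonalsSolving {n} B x = begin
  ∑ᵥ (λ d → 𝟙 (does (isSol? (withDiag B d) x)))
    ≡⟨ cong sum (map-cong (λ d → 𝟙-all? (λ i → holdsAt? B x i (d i))) (allVecs n)) ⟩
  ∑ᵥ (λ d → ∏ (λ i → 𝟙 (does (holdsAt? B x i (d i)))))
    ≡⟨ ∑ᵥ-∏ n (λ i b → 𝟙 (does (holdsAt? B x i b))) ⟩
  ∏ (λ i → 𝟙 (does (holdsAt? B x i false)) + 𝟙 (does (holdsAt? B x i true)))
    ≡⟨ sum-cong-≗ (holdsAt-count B x) ⟩
  ∏ (diagChoices ∘ x)
    ∎

lemma1 : (n : ℕ) (B : BMat n) → totalSol B ≡ 3 ^ n
lemma1 n B = begin
  totalSol B
    ≡⟨ cong sum (map-cong (λ d → length-filter≡sum-𝟙 (isSol? (withDiag B d)) (allVecs n)) (allVecs n)) ⟩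
  ∑ᵥ (λ d → ∑ᵥ (λ x → 𝟙 (does (isSol? (withDiag B d) x))))
    ≡⟨ sum-map-swap (λ d x → 𝟙 (does (isSol? (withDiag B d) x))) (allVecs n) (allVecs n) ⟩
  ∑ᵥ (λ x → ∑ᵥ (λ d → 𝟙 (does (isSol? (withDiag B d) x))))
    ≡⟨ cong sum (map-cong (diagonalsSolving B) (allVecs n)) ⟩
  ∑ᵥ {n} (λ x → ∏ (diagChoices ∘ x))
    ≡⟨ ∑ᵥ-∏ n (λ _ → diagChoices) ⟩
  ∏ {n} (λ _ → 3)
    ≡⟨ ∏-const n 3 ⟩
  3 ^ n
    ∎
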